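{- For any pair of colored tensors $T_1,T_2$, $\chi(T_1\otimes T_2)\le\chi(T_1)\chi(T_2)$.
   Context: A colored tensor is a pair $(I,P)$ with $P\subset A\times B\times C$ (support of a $\{0,1\}$-valued tensor) and $I\subset P$. With coordinate projections $\pi_i$, $S\subset I$ is independent if each element of $\pi_1(S)$ (resp. $\pi_2(S),\pi_3(S)$) lies in exactly one triple of $S$ and $P\cap(\pi_1(S)\times\pi_2(S)\times\pi_3(S))=S$; $\chi(I,P)$ is the least $k$ such that there is $\tau:I\to[k]$ all of whose color classes are independent. The Kronecker product $(I_1,P_1)\otimes(I_2,P_2)$ is the colored tensor over $(A_1\times A_2)\times(B_1\times B_2)\times(C_1\times C_2)$ with support $\{((a_1,a_2),(b_1,b_2),(c_1,c_2)) : (a_i,b_i,c_i)\in P_i\}$ and green set $\{((a_1,a_2),(b_1,b_2),(c_1,c_2)) : (a_i,b_i,c_i)\in I_i\}$. -}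

module Defs where

open import Data.Nat using (ℕ; _*_; _<_)
open import Data.Fin using (Fin; remQuot)
open import Data.Bool using (Bool; T; _∧_)
open import Data.Bool.Properties using (T-∧)
open import Data.Product using (Σ; ∃; _×_; _,_; proj₁; proj₂)
open import Relation.Binary.PropositionalEquality using (_≡_)
open import Relation.Nullary using (¬_)
open import Function.Bundles using (Equivalence)

-- A colored tensor over finite index sets A = Fin na, B = Fin nb, C = Fin nc.
-- P is the support of a {0,1}-valued tensor (given by its characteristic
-- function), I ⊆ P is the green set.
record ColoredTensor : Set where
  field
    na nb nc : ℕ
    P : Fin na → Fin nb → Fin nc → Bool
    I : Fin na → Fin nb → Fin nc → Bool
    I⊆P : ∀ a b c → T (I a b c) → T (P a b c)
open ColoredTensor public

_⊗_ : ColoredTensor → ColoredTensor → ColoredTensor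
T₁ ⊗ T₂ = record
  { na = na T₁ * na T₂
  ; nb = nb T₁ * nb T₂
  ; nc = nc T₁ * nc T₂
  ; P = λ a b c → P T₁ (fst a) (fst' b) (fst'' c) ∧ P T₂ (snd a) (snd' b) (snd'' c)
  ; I = λ a b c → I T₁ (fst a) (fst' b) (fst'' c) ∧ I T₂ (snd a) (snd' b) (snd'' c)
  ; I⊆P = λ a b c g →
      let g₁g₂ = Equivalence.to T-∧ g in
      Equivalence.from T-∧
        ( I⊆P T₁ (fst a) (fst' b) (fst'' c) (proj₁ g₁g₂)
        , I⊆P T₂ (snd a) (snd' b) (snd'' c) (proj₂ g₁g₂))
  }
  where
  fst = λ a → proj₁ (remQuot {na T₁} (na T₂) a)
  snd = λ a → proj₂ (remQuot {na T₁} (na T₂) a)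
  fst' = λ b → proj₁ (remQuot {nb T₁} (nb T₂) b)
  snd' = λ b → proj₂ (remQuot {nb T₁} (nb T₂) b)
  fst'' = λ c → proj₁ (remQuot {nc T₁} (nc T₂) c)
  snd'' = λ c → proj₂ (remQuot {nc T₁} (nc T₂) c)

Triples : ColoredTensor → Set₁
Triples T = Fin (na T) → Fin (nb T) → Fin (nc T) → Set

record Independent (Ten : ColoredTensor) (S : Triples Ten) : Set where
  field
    unique₁ : ∀ a b c b' c' → S a b c → S a b' c' → (b ≡ b') × (c ≡ c')
    unique₂ : ∀ a b c a' c' → S a b c → S a' b c' → (a ≡ a') × (c ≡ c')
    unique₃ : ∀ a b c a' b' → S a b c → S a' b' c → (a ≡ a') × (b ≡ b')
    closed  : ∀ a b c → T (P Ten a b c)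
              → (∃ λ b' → ∃ λ c' → S a b' c')
              → (∃ λ a' → ∃ λ c' → S a' b c')
              → (∃ λ a' → ∃ λ b' → S a' b' c)
              → S a b c

Coloring : ColoredTensor → ℕ → Set
Coloring Ten k = ∀ a b c → T (I Ten a b c) → Fin k

colorClass : (Ten : ColoredTensor) {k : ℕ} → Coloring Ten k → Fin k → Triples Ten
colorClass Ten τ j a b c = Σ (T (I Ten a b c)) λ g → τ a b c g ≡ j

Colorable : ColoredTensor → ℕ → Set
Colorable Ten k = Σ (Coloring Ten k) λ τ → ∀ j → Independent Ten (colorClass Ten τ j)

IsChi : ColoredTensor → ℕ → Set
IsChi Ten k = Colorable Ten k × (∀ j → j < k → ¬ Colorable Ten j)

-- If τ₁ and τ₂ color T₁ and T₂ with independent color classes, then the color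
-- classes of the coloring (τ₁, τ₂) of T₁ ⊗ T₂ are Kronecker products of color
-- classes of τ₁ and τ₂, and a Kronecker product of independent sets is
-- independent, coordinate by coordinate.  So T₁ ⊗ T₂ is (k₁ k₂)-colorable.
-- Colorability is decidable, as there are finitely many colorings, so the
-- least k for which T₁ ⊗ T₂ is k-colorable exists and is at most k₁ k₂.
module Submission where

open import Defs
open import Data.Nat using (ℕ; zero; suc; _*_; _≤_; _<_)
open import Data.Nat.Properties using (m<1+n⇒m≤n; m<n⇒m<1+n; n<1+n; m<1+n⇒m<n∨m≡n)
open import Data.Fin using (Fin; zero; remQuot; combine; _≟_)
open import Data.Fin.Properties using (¬Fin0; any?; all?; remQuot-combine; combine-remQuot)
open import Data.Vec using (Vec; []; _∷_; lookup; tabulate)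
open import Data.Vec.Properties using (lookup∘tabulate)
open import Data.Bool using (Bool; true; false; T)
open import Data.Bool.Properties using (T-∧; T-irrelevant)
open import Data.Product using (Σ; ∃; _×_; _,_; proj₁; proj₂; map₂; zip′)
open import Data.Sum using (_⊎_; inj₁; inj₂)
open import Data.Unit using (tt)
open import Function using (_∘_)
open import Function.Bundles using (Equivalence)
open import Level using (0ℓ)
open import Relation.Binary.PropositionalEquality
  using (_≡_; refl; sym; trans; cong; cong₂; module ≡-Reasoning)
open import Relation.Nullary using (¬_; Dec; yes; no; ¬?; contradiction)
open import Relation.Nullary.Decidable using (map′; T?; _×-dec_; _→-dec_)
open import Relation.Unary using (Pred; Decidable)

Least : (ℕ → Set) → ℕ → Set
Least P k = P k × (∀ j → j < k → ¬ P j)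

least-below-or-none : {P : ℕ → Set} → Decidable P → ∀ n →
  (∃ λ k → k < n × Least P k) ⊎ (∀ j → j < n → ¬ P j)
least-below-or-none P? zero = inj₂ λ _ ()
least-below-or-none {P} P? (suc n) with least-below-or-none P? n
... | inj₁ (k , k<n , least) = inj₁ (k , m<n⇒m<1+n k<n , least)
... | inj₂ none with P? n
...   | yes p = inj₁ (n , n<1+n n , p , none)
...   | no ¬p = inj₂ λ j j<1+n → none-≤ j (m<1+n⇒m<n∨m≡n j<1+n)
  where
  none-≤ : ∀ j → j < n ⊎ j ≡ n → ¬ P j
  none-≤ j (inj₁ j<n) = none j j<n
  none-≤ j (inj₂ refl) = ¬p

least-≤ : {P : ℕ → Set} → Decidable P → ∀ {n} → P n → ∃ λ k → Least P k × k ≤ n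
least-≤ P? {n} p with least-below-or-none P? (suc n)
... | inj₁ (k , k<1+n , least) = k , least , m<1+n⇒m≤n k<1+n
... | inj₂ none = contradiction p (none n (n<1+n n))

Searchable : Set → Set₁
Searchable A = {Q : Pred A 0ℓ} → Decidable Q → Dec (∃ Q)

Fin-searchable : ∀ n → Searchable (Fin n)
Fin-searchable n = any?

Vec-searchable : ∀ {A} n → Searchable A → Searchable (Vec A n)
Vec-searchable zero search Q? = map′ ([] ,_) (λ { ([] , q) → q }) (Q? [])
Vec-searchable (suc n) search Q? =
  map′ (λ (x , xs , q) → x ∷ xs , q) (λ { (x ∷ xs , q) → x , xs , q })
       (search λ x → Vec-searchable n search (Q? ∘ (x ∷_)))

_⊆³_ : {A B C : Set} → (A → B → C → Set) → (A → B → C → Set) → Set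
S ⊆³ S' = ∀ {a b c} → S a b c → S' a b c

Decidable³ : {A B C : Set} → (A → B → C → Set) → Set
Decidable³ S = ∀ a b c → Dec (S a b c)

Independent-resp : ∀ {Ten} {S S' : Triples Ten} →
  S ⊆³ S' → S' ⊆³ S → Independent Ten S → Independent Ten S'
Independent-resp S⊆S' S'⊆S ind = record
  { unique₁ = λ a b c b' c' s s' → unique₁ a b c b' c' (S'⊆S s) (S'⊆S s')
  ; unique₂ = λ a b c a' c' s s' → unique₂ a b c a' c' (S'⊆S s) (S'⊆S s')
  ; unique₃ = λ a b c a' b' s s' → unique₃ a b c a' b' (S'⊆S s) (S'⊆S s')
  ; closed  = λ a b c p s₁ s₂ s₃ →
      S⊆S' (closed a b c p (map₂ (map₂ S'⊆S) s₁) (map₂ (map₂ S'⊆S) s₂) (map₂ (map₂ S'⊆S) s₃))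
  }
  where open Independent ind

Independent? : ∀ Ten {S : Triples Ten} → Decidable³ S → Dec (Independent Ten S)
Independent? Ten {S} S? =
  map′ (λ (u₁ , u₂ , u₃ , cl) → record { unique₁ = u₁ ; unique₂ = u₂ ; unique₃ = u₃ ; closed = cl })
       (λ ind → let open Independent ind in unique₁ , unique₂ , unique₃ , closed)
       (unique₁? ×-dec unique₂? ×-dec unique₃? ×-dec closed?)
  where
  unique₁? : Dec (∀ a b c b' c' → S a b c → S a b' c' → (b ≡ b') × (c ≡ c'))
  unique₁? = all? λ a → all? λ b → all? λ c → all? λ b' → all? λ c' →
    S? a b c →-dec S? a b' c' →-dec ((b ≟ b') ×-dec (c ≟ c'))
  unique₂? : Dec (∀ a b c a' c' → S a b c → S a' b c' → (a ≡ a') × (c ≡ c'))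
  unique₂? = all? λ a → all? λ b → all? λ c → all? λ a' → all? λ c' →
    S? a b c →-dec S? a' b c' →-dec ((a ≟ a') ×-dec (c ≟ c'))
  unique₃? : Dec (∀ a b c a' b' → S a b c → S a' b' c → (a ≡ a') × (b ≡ b'))
  unique₃? = all? λ a → all? λ b → all? λ c → all? λ a' → all? λ b' →
    S? a b c →-dec S? a' b' c →-dec ((a ≟ a') ×-dec (b ≟ b'))
  closed? : Dec (∀ a b c → T (P Ten a b c)
                  → (∃ λ b' → ∃ λ c' → S a b' c')
                  → (∃ λ a' → ∃ λ c' → S a' b c')
                  → (∃ λ a' → ∃ λ b' → S a' b' c)
                  → S a b c)
  closed? = all? λ a → all? λ b → all? λ c →
    T? (P Ten a b c)
      →-dec (any? λ b' → any? λ c' → S? a b' c')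
      →-dec (any? λ a' → any? λ c' → S? a' b c')
      →-dec (any? λ a' → any? λ b' → S? a' b' c)
      →-dec S? a b c

coloring-irrelevant : ∀ Ten {k} (τ : Coloring Ten k) {a b c} (g g' : T (I Ten a b c)) →
  τ a b c g ≡ τ a b c g'
coloring-irrelevant Ten τ g g' = cong (τ _ _ _) (T-irrelevant g g')

colorClass? : ∀ Ten {k} (τ : Coloring Ten k) j → Decidable³ (colorClass Ten τ j)
colorClass? Ten τ j a b c with T? (I Ten a b c)
... | no ¬g = no (¬g ∘ proj₁)
... | yes g = map′ (g ,_) (λ (g' , e) → trans (coloring-irrelevant Ten τ g g') e) (τ a b c g ≟ j)

colorClass-resp : ∀ Ten {k} {τ τ' : Coloring Ten k} → (∀ a b c g → τ a b c g ≡ τ' a b c g) →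
  ∀ j → Independent Ten (colorClass Ten τ j) → Independent Ten (colorClass Ten τ' j)
colorClass-resp Ten τ≗τ' j = Independent-resp
  (λ (g , e) → g , trans (sym (τ≗τ' _ _ _ g)) e)
  (λ (g , e) → g , trans (τ≗τ' _ _ _ g) e)

Vec³ : Set → ℕ → ℕ → ℕ → Set
Vec³ A l m n = Vec (Vec (Vec A n) m) l

lookup³ : ∀ {A l m n} → Vec³ A l m n → Fin l → Fin m → Fin n → A
lookup³ t a b c = lookup (lookup (lookup t a) b) c

tabulate³ : ∀ {A l m n} → (Fin l → Fin m → Fin n → A) → Vec³ A l m n
tabulate³ f = tabulate λ a → tabulate λ b → tabulate λ c → f a b c

lookup³∘tabulate³ : ∀ {A l m n} (f : Fin l → Fin m → Fin n → A) a b c →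
  lookup³ (tabulate³ f) a b c ≡ f a b c
lookup³∘tabulate³ f a b c = begin
  lookup (lookup (lookup (tabulate³ f) a) b) c              ≡⟨ cong (λ t → lookup (lookup t b) c) (lookup∘tabulate _ a) ⟩
  lookup (lookup (tabulate λ b → tabulate (f a b)) b) c     ≡⟨ cong (λ t → lookup t c) (lookup∘tabulate _ b) ⟩
  lookup (tabulate (f a b)) c                               ≡⟨ lookup∘tabulate (f a b) c ⟩
  f a b c                                                   ∎
  where open ≡-Reasoning

-- Colorings are enumerated as tables of colors: a search over functions would
-- need the searched predicate to respect pointwise equality.
Table : ColoredTensor → ℕ → Set
Table Ten k = Vec³ (Fin k) (na Ten) (nb Ten) (nc Ten)

Table-searchable : ∀ Ten k → Searchable (Table Ten k)
Table-searchable Ten k = Vec-searchable _ (Vec-searchable _ (Vec-searchable _ (Fin-searchable k)))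

lookupColoring : ∀ Ten {k} → Table Ten k → Coloring Ten k
lookupColoring Ten t a b c _ = lookup³ t a b c

ifT : {A : Set} (b : Bool) → (T b → A) → A → A
ifT true  f _ = f tt
ifT false _ d = d

ifT-T : {A : Set} (b : Bool) (f : T b → A) (d : A) (t : T b) → ifT b f d ≡ f t
ifT-T true f d tt = refl

-- Off the green set the table holds an arbitrary color, so it needs k > 0.
tabulateColoring : ∀ Ten {k} → Coloring Ten (suc k) → Table Ten (suc k)
tabulateColoring Ten τ = tabulate³ λ a b c → ifT (I Ten a b c) (τ a b c) zero

lookup∘tabulateColoring : ∀ Ten {k} (τ : Coloring Ten (suc k)) a b c g →
  lookupColoring Ten (tabulateColoring Ten τ) a b c g ≡ τ a b c g
lookup∘tabulateColoring Ten τ a b c g =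
  trans (lookup³∘tabulate³ _ a b c) (ifT-T (I Ten a b c) (τ a b c) zero g)

colorable? : ∀ Ten k → Dec (Colorable Ten k)
colorable? Ten zero =
  map′ (λ noGreen → (λ a b c g → contradiction g (noGreen a b c)) , λ ())
       (λ (τ , _) a b c g → ¬Fin0 (τ a b c g))
       (all? λ a → all? λ b → all? λ c → ¬? (T? (I Ten a b c)))
colorable? Ten (suc k) =
  map′ (λ (t , ind) → lookupColoring Ten t , ind)
       (λ (τ , ind) → tabulateColoring Ten τ ,
          λ j → colorClass-resp Ten (λ a b c g → sym (lookup∘tabulateColoring Ten τ a b c g)) j (ind j))
       (Table-searchable Ten (suc k) λ t → all? λ j → Independent? Ten (colorClass? Ten (lookupColoring Ten t) j))

factor₁ : ∀ m n → Fin (m * n) → Fin m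
factor₁ m n i = proj₁ (remQuot {m} n i)

factor₂ : ∀ m n → Fin (m * n) → Fin n
factor₂ m n i = proj₂ (remQuot {m} n i)

factor-injective : ∀ m n {i i' : Fin (m * n)} →
  factor₁ m n i ≡ factor₁ m n i' → factor₂ m n i ≡ factor₂ m n i' → i ≡ i'
factor-injective m n {i} {i'} e₁ e₂ = begin
  i                                         ≡⟨ combine-remQuot {m} n i ⟨
  combine (factor₁ m n i) (factor₂ m n i)   ≡⟨ cong₂ combine e₁ e₂ ⟩
  combine (factor₁ m n i') (factor₂ m n i') ≡⟨ combine-remQuot {m} n i' ⟩
  i'                                        ∎
  where open ≡-Reasoning

module Kronecker (T₁ T₂ : ColoredTensor) where

  fstᴬ : Fin (na T₁ * na T₂) → Fin (na T₁)
  fstᴬ = factor₁ (na T₁) (na T₂)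
  sndᴬ : Fin (na T₁ * na T₂) → Fin (na T₂)
  sndᴬ = factor₂ (na T₁) (na T₂)
  fstᴮ : Fin (nb T₁ * nb T₂) → Fin (nb T₁)
  fstᴮ = factor₁ (nb T₁) (nb T₂)
  sndᴮ : Fin (nb T₁ * nb T₂) → Fin (nb T₂)
  sndᴮ = factor₂ (nb T₁) (nb T₂)
  fstᶜ : Fin (nc T₁ * nc T₂) → Fin (nc T₁)
  fstᶜ = factor₁ (nc T₁) (nc T₂)
  sndᶜ : Fin (nc T₁ * nc T₂) → Fin (nc T₂)
  sndᶜ = factor₂ (nc T₁) (nc T₂)

  _⊠_ : Triples T₁ → Triples T₂ → Triples (T₁ ⊗ T₂)
  (S₁ ⊠ S₂) a b c = S₁ (fstᴬ a) (fstᴮ b) (fstᶜ c) × S₂ (sndᴬ a) (sndᴮ b) (sndᶜ c)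

  ⊠-independent : ∀ {S₁ S₂} → Independent T₁ S₁ → Independent T₂ S₂ → Independent (T₁ ⊗ T₂) (S₁ ⊠ S₂)
  ⊠-independent ind₁ ind₂ = record
    { unique₁ = λ a b c b' c' (s₁ , s₂) (s₁' , s₂') →
        zip′ ≡ᴮ ≡ᶜ (I₁.unique₁ _ _ _ _ _ s₁ s₁') (I₂.unique₁ _ _ _ _ _ s₂ s₂')
    ; unique₂ = λ a b c a' c' (s₁ , s₂) (s₁' , s₂') →
        zip′ ≡ᴬ ≡ᶜ (I₁.unique₂ _ _ _ _ _ s₁ s₁') (I₂.unique₂ _ _ _ _ _ s₂ s₂')
    ; unique₃ = λ a b c a' b' (s₁ , s₂) (s₁' , s₂') →
        zip′ ≡ᴬ ≡ᴮ (I₁.unique₃ _ _ _ _ _ s₁ s₁') (I₂.unique₃ _ _ _ _ _ s₂ s₂')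
    ; closed = λ a b c p (b' , c' , s₁ , s₂) (a' , c'' , t₁ , t₂) (a'' , b'' , u₁ , u₂) →
        let (p₁ , p₂) = Equivalence.to T-∧ p in
        I₁.closed _ _ _ p₁ (fstᴮ b' , fstᶜ c' , s₁) (fstᴬ a' , fstᶜ c'' , t₁) (fstᴬ a'' , fstᴮ b'' , u₁) ,
        I₂.closed _ _ _ p₂ (sndᴮ b' , sndᶜ c' , s₂) (sndᴬ a' , sndᶜ c'' , t₂) (sndᴬ a'' , sndᴮ b'' , u₂)
    }
    where
    module I₁ = Independent ind₁
    module I₂ = Independent ind₂
    ≡ᴬ : ∀ {a a'} → fstᴬ a ≡ fstᴬ a' → sndᴬ a ≡ sndᴬ a' → a ≡ a'
    ≡ᴬ = factor-injective (na T₁) (na T₂)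
    ≡ᴮ : ∀ {b b'} → fstᴮ b ≡ fstᴮ b' → sndᴮ b ≡ sndᴮ b' → b ≡ b'
    ≡ᴮ = factor-injective (nb T₁) (nb T₂)
    ≡ᶜ : ∀ {c c'} → fstᶜ c ≡ fstᶜ c' → sndᶜ c ≡ sndᶜ c' → c ≡ c'
    ≡ᶜ = factor-injective (nc T₁) (nc T₂)

  green-split : ∀ a b c → T (I (T₁ ⊗ T₂) a b c) →
    T (I T₁ (fstᴬ a) (fstᴮ b) (fstᶜ c)) × T (I T₂ (sndᴬ a) (sndᴮ b) (sndᶜ c))
  green-split a b c = Equivalence.to T-∧

  _⊗ᶜ_ : ∀ {k₁ k₂} → Coloring T₁ k₁ → Coloring T₂ k₂ → Coloring (T₁ ⊗ T₂) (k₁ * k₂)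
  (τ₁ ⊗ᶜ τ₂) a b c g =
    combine (τ₁ _ _ _ (proj₁ (green-split a b c g))) (τ₂ _ _ _ (proj₂ (green-split a b c g)))

  module _ {k₁ k₂} (τ₁ : Coloring T₁ k₁) (τ₂ : Coloring T₂ k₂) (j : Fin (k₁ * k₂)) where

    colorClass-⊗ : Triples (T₁ ⊗ T₂)
    colorClass-⊗ = colorClass (T₁ ⊗ T₂) (τ₁ ⊗ᶜ τ₂) j

    colorClass-⊠ : Triples (T₁ ⊗ T₂)
    colorClass-⊠ = colorClass T₁ τ₁ (factor₁ k₁ k₂ j) ⊠ colorClass T₂ τ₂ (factor₂ k₁ k₂ j)

    colorClass-⊗⊆⊠ : colorClass-⊗ ⊆³ colorClass-⊠
    colorClass-⊗⊆⊠ {a} {b} {c} (g , e) = (g₁ , cong proj₁ colors) , (g₂ , cong proj₂ colors)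
      where
      g₁ : T (I T₁ (fstᴬ a) (fstᴮ b) (fstᶜ c))
      g₁ = proj₁ (green-split a b c g)
      g₂ : T (I T₂ (sndᴬ a) (sndᴮ b) (sndᶜ c))
      g₂ = proj₂ (green-split a b c g)
      colors : (τ₁ _ _ _ g₁ , τ₂ _ _ _ g₂) ≡ remQuot {k₁} k₂ j
      colors = trans (sym (remQuot-combine _ _)) (cong (remQuot {k₁} k₂) e)

    colorClass-⊠⊆⊗ : colorClass-⊠ ⊆³ colorClass-⊗
    colorClass-⊠⊆⊗ {a} {b} {c} ((g₁ , e₁) , (g₂ , e₂)) = g , (begin
      (τ₁ ⊗ᶜ τ₂) a b c g                            ≡⟨ cong₂ combine
                                                         (trans (coloring-irrelevant T₁ τ₁ _ g₁) e₁)
                                                         (trans (coloring-irrelevant T₂ τ₂ _ g₂) e₂) ⟩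
      combine (factor₁ k₁ k₂ j) (factor₂ k₁ k₂ j)   ≡⟨ combine-remQuot {k₁} k₂ j ⟩
      j                                             ∎)
      where
      open ≡-Reasoning
      g : T (I (T₁ ⊗ T₂) a b c)
      g = Equivalence.from T-∧ (g₁ , g₂)

  ⊗-colorable : ∀ {k₁ k₂} → Colorable T₁ k₁ → Colorable T₂ k₂ → Colorable (T₁ ⊗ T₂) (k₁ * k₂)
  ⊗-colorable (τ₁ , ind₁) (τ₂ , ind₂) = τ₁ ⊗ᶜ τ₂ , λ j →
    Independent-resp (colorClass-⊠⊆⊗ τ₁ τ₂ j) (colorClass-⊗⊆⊠ τ₁ τ₂ j) (⊠-independent (ind₁ _) (ind₂ _))

open Kronecker using (⊗-colorable)

mainTheorem8 : (T₁ T₂ : ColoredTensor) (k₁ k₂ : ℕ)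
    → IsChi T₁ k₁ → IsChi T₂ k₂
    → Σ ℕ (λ k → IsChi (T₁ ⊗ T₂) k × k ≤ k₁ * k₂)
mainTheorem8 T₁ T₂ k₁ k₂ (colorable₁ , _) (colorable₂ , _) =
  least-≤ (colorable? (T₁ ⊗ T₂)) (⊗-colorable T₁ T₂ colorable₁ colorable₂)
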